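{- Let $\phi = \frac{1+\sqrt5}{2}$, $a(k) = \lfloor k\phi\rfloor$, $b(k) = \lfloor k\phi^2\rfloor$, $A = \{a(k)\}_{k\ge1}$, $B = \{b(k)\}_{k \ge 1}$. Let $D = \{3a(k)+k : k \ge 1\}$, $C = D \pm 2$ and $S = C \pm 1$, and let $d(k)$, $c(k)$, $s(k)$ denote the $k$-th smallest elements of $D$, $C$, $S$ respectively. Then for every $k \ge 1$, \[ (s(k),c(k),d(k)) \in (A\times A\times A)\cup(A\times A\times B)\cup(A\times B\times A)\cup(B\times A\times A)\cup(B\times B\times A)\cup(B\times A\times B). \]
   Context: For a set $X$ of integers and an integer $r$, $X \pm r = \{x+r : x\in X\}\cup\{x-r : x \in X\}$. The sets $A$ and $B$ partition the positive integers (Beatty's theorem), and $D, C, S$ partition the positive integers. -}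

module Defs where

open import Data.Nat using (ℕ; zero; suc; _+_; _*_; _∸_; _≤ᵇ_; _≡ᵇ_)
open import Data.Bool using (Bool; true; false; _∧_; _∨_; if_then_else_)
open import Relation.Binary.PropositionalEquality using (_≡_)

-- φ = (1+√5)/2,  φ² = (3+√5)/2.  No reals in the stdlib, so the real
-- comparisons are unfolded exactly into integer arithmetic:
--   n ≤ kφ   ⇔  2n ≤ k + k√5   ⇔  2n ≤ k  or  (2n−k)² ≤ 5k²
--   n ≤ kφ²  ⇔  2n ≤ 3k + k√5  ⇔  2n ≤ 3k or  (2n−3k)² ≤ 5k²
leφ : ℕ → ℕ → Bool
leφ k n = (2 * n ≤ᵇ k) ∨ (((2 * n ∸ k) * (2 * n ∸ k)) ≤ᵇ 5 * (k * k))

leφ² : ℕ → ℕ → Bool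
leφ² k n = (2 * n ≤ᵇ 3 * k) ∨ (((2 * n ∸ 3 * k) * (2 * n ∸ 3 * k)) ≤ᵇ 5 * (k * k))

-- largest n ≤ bound with p n (0 if none); used for floors of x ≥ 0 with x < bound
findMax : (ℕ → Bool) → ℕ → ℕ
findMax p zero = zero
findMax p (suc m) = if p (suc m) then suc m else findMax p m

-- a(k) = ⌊kφ⌋  (kφ < 3k),  b(k) = ⌊kφ²⌋  (kφ² < 3k)
a : ℕ → ℕ
a k = findMax (leφ k) (3 * k)

b : ℕ → ℕ
b k = findMax (leφ² k) (3 * k)

existsPos : ℕ → (ℕ → Bool) → Bool
existsPos zero p = false
existsPos (suc n) p = p (suc n) ∨ existsPos n p

-- membership predicates (the witness k satisfies k ≤ n since a(k), b(k), 3a(k)+k ≥ k)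
inA : ℕ → Bool
inA n = existsPos n (λ k → a k ≡ᵇ n)

inB : ℕ → Bool
inB n = existsPos n (λ k → b k ≡ᵇ n)

inD : ℕ → Bool
inD n = existsPos n (λ k → (3 * a k + k) ≡ᵇ n)

pm : (ℕ → Bool) → ℕ → ℕ → Bool
pm X r n = X (n + r) ∨ ((r ≤ᵇ n) ∧ X (n ∸ r))

inC : ℕ → Bool
inC = pm inD 2

inS : ℕ → Bool
inS = pm inC 1

-- number of n with 1 ≤ n < m and X n
countBelow : (ℕ → Bool) → ℕ → ℕ
countBelow X zero = zero
countBelow X (suc zero) = zero
countBelow X (suc (suc m)) =
  countBelow X (suc m) + (if X (suc m) then 1 else 0)

KthSmallest : (ℕ → Bool) → ℕ → ℕ → Set
KthSmallest X k m = (1 Data.Nat.≤ m) Data.Product.× (X m ≡ true) Data.Product.× (suc (countBelow X m) ≡ k)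
  where import Data.Nat
        import Data.Product

InA InB : ℕ → Set
InA n = inA n ≡ true
InB n = inB n ≡ true

module Submission where

-- Numbers x + yφ (x, y ∈ ℕ) are compared exactly through Fibonacci
-- evaluations x·Fᵢ + y·Fᵢ₊₁ (the order _≻_ on ℕφ).  It is compatible with
-- addition and with multiplication by φ, so each inequality used later is a
-- nonnegative combination of known ones up to a ring identity (≻-transfer).
-- A descent argument (φ-lower, φ-upper) identifies the tests leφ, leφ² of
-- Defs with these comparisons, so a(k) and b(k) are genuine floors.
-- Writing k = 1 + t + v with a(k) = 1 + 2t + v (Window), all values of a
-- and b that are needed become floors of explicit polynomials in t, v; this
-- yields Beatty's theorem, the identities for a(a(j)) and a(a(j) + 1), and
-- explicit increasing enumerations d(k) = 3a(k)+k, c(k) = a(k)+2k−1 and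
-- s = c ∓ 1 interleaved (Enumerates).  Finally c(k) = 2+4t+3v and
-- d(k) = 4+7t+4v are located in A or B in three cases (cd-pattern), and
-- s(k) ∈ A ∪ B by Beatty's theorem.

open import Defs
open import Data.Nat using (ℕ; zero; suc; _+_; _*_; _∸_; _≤_; _<_; _≤?_; _<?_; _≤ᵇ_; _≡ᵇ_; s≤s; z≤n; >-nonZero)
open import Data.Nat.Properties
open import Data.Nat.Induction using (<-wellFounded)
open import Data.Nat.Tactic.RingSolver using (solve)
open import Algebra.Properties.CommutativeSemigroup +-commutativeSemigroup using (interchange)
open import Induction.WellFounded using (Acc; acc)
open import Data.Bool using (Bool; true; false; T; _∨_; _∧_; if_then_else_)
open import Data.Bool.Properties using (∨-zeroʳ; T-≡)
open import Data.Product using (Σ; _×_; _,_; proj₁)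
open import Data.Sum using (_⊎_; inj₁; inj₂)
open import Data.Empty using (⊥; ⊥-elim)
open import Data.List using (_∷_; [])
open import Function.Bundles using (Equivalence)
open import Relation.Nullary using (yes; no)
open import Relation.Nullary.Decidable using (True; toWitness; _×-dec_)
open import Relation.Binary.PropositionalEquality

-- ℕφ: a pair (x , y) stands for the real number x + yφ.
ℕφ : Set
ℕφ = ℕ × ℕ

infixl 6 _⊕_
infix 4 _≻[_]_ _≻_

_⊕_ : ℕφ → ℕφ → ℕφ
(x , y) ⊕ (x' , y') = (x + x' , y + y')

-- Multiplication by φ, using φ² = φ + 1.
φ· : ℕφ → ℕφ
φ· (x , y) = (y , x + y)

-- ev i (x , y) = x·Fᵢ + y·Fᵢ₊₁ (Fibonacci numbers); ev i u / Fᵢ → x + yφ.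
ev : ℕ → ℕφ → ℕ
ev zero (x , y) = y
ev (suc zero) (x , y) = x + y
ev (suc (suc i)) u = ev i u + ev (suc i) u

-- u ≻[ i ] v: u beats v at two consecutive Fibonacci evaluations i, i+1.
-- Since ev (i+2) = ev i + ev (i+1) it then beats v at every later index,
-- so u > v as real numbers; _≻_ is this strict order on ℕφ.
_≻[_]_ : ℕφ → ℕ → ℕφ → Set
u ≻[ i ] v = ev i v < ev i u × ev (suc i) v < ev (suc i) u

record _≻_ (u v : ℕφ) : Set where
  constructor certified
  field
    index : ℕ
    evidence : u ≻[ index ] v

ev-⊕ : ∀ i u w → ev i (u ⊕ w) ≡ ev i u + ev i w
ev-⊕ zero (x , y) (x' , y') = refl
ev-⊕ (suc zero) (x , y) (x' , y') = interchange x x' y y'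
ev-⊕ (suc (suc i)) u w = trans (cong₂ _+_ (ev-⊕ i u w) (ev-⊕ (suc i) u w))
  (interchange (ev i u) (ev i w) (ev (suc i) u) (ev (suc i) w))

ev-φ· : ∀ i u → ev i (φ· u) ≡ ev (suc i) u
ev-φ· zero (x , y) = refl
ev-φ· (suc zero) (x , y) = refl
ev-φ· (suc (suc i)) u = cong₂ _+_ (ev-φ· i u) (ev-φ· (suc i) u)

ev-scale : ∀ i k x y → ev i (k * x , k * y) ≡ k * ev i (x , y)
ev-scale zero k x y = refl
ev-scale (suc zero) k x y = sym (*-distribˡ-+ k x y)
ev-scale (suc (suc i)) k x y =
  trans (cong₂ _+_ (ev-scale i k x y) (ev-scale (suc i) k x y)) (sym (*-distribˡ-+ k _ _))

_≼_ : ℕφ → ℕφ → Set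
(x , y) ≼ (x' , y') = x ≤ x' × y ≤ y'

ev-mono : ∀ i {u w} → u ≼ w → ev i u ≤ ev i w
ev-mono zero {x , y} {x' , y'} (x≤ , y≤) = y≤
ev-mono (suc zero) {x , y} {x' , y'} (x≤ , y≤) = +-mono-≤ x≤ y≤
ev-mono (suc (suc i)) u≼w = +-mono-≤ (ev-mono i u≼w) (ev-mono (suc i) u≼w)

≻-later : ∀ d {i u v} → u ≻[ i ] v → u ≻[ d + i ] v
≻-later zero h = h
≻-later (suc d) {i} h with ≻-later d {i} h
... | p , q = q , +-mono-< p q

≻-common : ∀ {u v u' v'} → u ≻ v → u' ≻ v' → Σ ℕ λ i → u ≻[ i ] v × u' ≻[ i ] v'
≻-common {u' = u'} {v'} (certified i h) (certified j h') =
  j + i , ≻-later j h , subst (λ z → u' ≻[ z ] v') (+-comm i j) (≻-later i h')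

≻-map : ∀ {u v u' v'} → (∀ i → ev i v < ev i u → ev i v' < ev i u') → u ≻ v → u' ≻ v'
≻-map f (certified i (p , q)) = certified i (f i p , f (suc i) q)

≻-+ : ∀ {x y x' y' z w z' w'} → (x , y) ≻ (x' , y') → (z , w) ≻ (z' , w') →
      (x + z , y + w) ≻ (x' + z' , y' + w')
≻-+ {x} {y} {x'} {y'} {z} {w} {z'} {w'} h h' with ≻-common h h'
... | i , (p , q) , (p' , q') = certified i (add i p p' , add (suc i) q q')
  where
  add : ∀ j → ev j (x' , y') < ev j (x , y) → ev j (z' , w') < ev j (z , w) →
        ev j (x' + z' , y' + w') < ev j (x + z , y + w)
  add j r r' = subst₂ _<_ (sym (ev-⊕ j (x' , y') (z' , w'))) (sym (ev-⊕ j (x , y) (z , w))) (+-mono-< r r')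

≻-+ˡ : ∀ w {u v} → u ≻ v → w ⊕ u ≻ w ⊕ v
≻-+ˡ w {u} {v} = ≻-map λ i r →
  subst₂ _<_ (sym (ev-⊕ i w v)) (sym (ev-⊕ i w u)) (+-monoʳ-< (ev i w) r)

≻-cancel : ∀ {u v w} → u ⊕ w ≻ v ⊕ w → u ≻ v
≻-cancel {u} {v} {w} = ≻-map λ i r →
  +-cancelʳ-< (ev i w) (ev i v) (ev i u) (subst₂ _<_ (ev-⊕ i v w) (ev-⊕ i u w) r)

2*n≡n+n : ∀ n → 2 * n ≡ n + n
2*n≡n+n n = cong (n +_) (+-identityʳ n)

≻-halve : ∀ {u v} → u ⊕ u ≻ v ⊕ v → u ≻ v
≻-halve {u} {v} = ≻-map λ i r →
  half (ev i v) (ev i u) (subst₂ _<_ (ev-⊕ i v v) (ev-⊕ i u u) r)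
  where
  half : ∀ m n → m + m < n + n → m < n
  half m n r = *-cancelˡ-< 2 m n (subst₂ _<_ (sym (2*n≡n+n m)) (sym (2*n≡n+n n)) r)

≻-φ· : ∀ {x y x' y'} → (x , y) ≻ (x' , y') → (y , x + y) ≻ (y' , x' + y')
≻-φ· {x} {y} {x'} {y'} (certified i (p , q)) = certified i
  (subst₂ _<_ (sym (ev-φ· i (x' , y'))) (sym (ev-φ· i (x , y))) q ,
   subst₂ _<_ (sym (ev-φ· (suc i) (x' , y'))) (sym (ev-φ· (suc i) (x , y))) (+-mono-< p q))

≻-unφ· : ∀ {u v} → φ· u ≻ φ· v → u ≻ v
≻-unφ· {u} {v} (certified i (p , q)) = certified (suc i)
  (subst₂ _<_ (ev-φ· i v) (ev-φ· i u) p , subst₂ _<_ (ev-φ· (suc i) v) (ev-φ· (suc i) u) q)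

≻-scale : ∀ k {x y x' y'} → 1 ≤ k → (x , y) ≻ (x' , y') → (k * x , k * y) ≻ (k * x' , k * y')
≻-scale k {x} {y} {x'} {y'} k≥1 = ≻-map λ i r →
  subst₂ _<_ (sym (ev-scale i k x' y')) (sym (ev-scale i k x y)) (*-monoʳ-< k {{>-nonZero k≥1}} r)

≻-monoˡ : ∀ {u u' v} → u ≼ u' → u ≻ v → u' ≻ v
≻-monoˡ u≼u' = ≻-map λ i r → <-≤-trans r (ev-mono i u≼u')

≻-monoʳ : ∀ {u v v'} → v' ≼ v → u ≻ v → u ≻ v'
≻-monoʳ v'≼v = ≻-map λ i r → ≤-<-trans (ev-mono i v'≼v) r

≻-≼-absurd : ∀ {u v} → u ≻ v → u ≼ v → ⊥
≻-≼-absurd (certified i (p , q)) u≼v = <-irrefl refl (<-≤-trans p (ev-mono i u≼v))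

≻-trans : ∀ {u v w} → u ≻ v → v ≻ w → u ≻ w
≻-trans {u} {v} {w} h h' = ≻-cancel {w = v}
  (subst (λ z → z ≻ w ⊕ v) (⊕-comm v u) (≻-+ h' h))
  where
  ⊕-comm : ∀ p q → p ⊕ q ≡ q ⊕ p
  ⊕-comm (x , y) (x' , y') = cong₂ _,_ (+-comm x x') (+-comm y y')

≻-asym : ∀ {u v} → u ≻ v → v ≻ u → ⊥
≻-asym {u} h h' = ≻-≼-absurd (≻-trans h h') (≤-refl , ≤-refl)

-- P' − Q' = P − Q, so P ≻ Q transfers to P' ≻ Q'.  The two equations are
-- ring identities, discharged at each use by the ring solver.
≻-transfer : ∀ {p₁ p₂ q₁ q₂ p₁' p₂' q₁' q₂'} → (p₁ , p₂) ≻ (q₁ , q₂) →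
             p₁' + q₁ ≡ q₁' + p₁ → p₂' + q₂ ≡ q₂' + p₂ → (p₁' , p₂') ≻ (q₁' , q₂')
≻-transfer {p₁} {p₂} {q₁} {q₂} {p₁'} {p₂'} {q₁'} {q₂'} h e₁ e₂ =
  ≻-cancel {w = (q₁ , q₂)} (subst₂ _≻_ (cong₂ _,_ (sym e₁) (sym e₂)) refl (≻-+ˡ (q₁' , q₂') h))

-- The same with φ(P' − Q') = P − Q, resp. φ²(P' − Q') = P − Q.
≻-transferφ : ∀ {p₁ p₂ q₁ q₂ p₁' p₂' q₁' q₂'} → (p₁ , p₂) ≻ (q₁ , q₂) →
              p₂' + q₁ ≡ q₂' + p₁ → (p₁' + p₂') + q₂ ≡ (q₁' + q₂') + p₂ → (p₁' , p₂') ≻ (q₁' , q₂')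
≻-transferφ h e₁ e₂ = ≻-unφ· (≻-transfer h e₁ e₂)

≻-transferφ² : ∀ {p₁ p₂ q₁ q₂ p₁' p₂' q₁' q₂'} → (p₁ , p₂) ≻ (q₁ , q₂) →
               (p₁' + p₂') + q₁ ≡ (q₁' + q₂') + p₁ →
               (p₂' + (p₁' + p₂')) + q₂ ≡ (q₂' + (q₁' + q₂')) + p₂ → (p₁' , p₂') ≻ (q₁' , q₂')
≻-transferφ² h e₁ e₂ = ≻-unφ· (≻-unφ· (≻-transfer h e₁ e₂))

≻-by-evaluation : ∀ i u v → {_ : True ((ev i v <? ev i u) ×-dec (ev (suc i) v <? ev (suc i) u))} → u ≻ v
≻-by-evaluation i u v {w} = certified i (toWitness w)

≻-ℕ : ∀ {m n} → (m , 0) ≻ (n , 0) → n < m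
≻-ℕ {m} {n} h with n <? m
... | yes n<m = n<m
... | no n≮m = ⊥-elim (≻-≼-absurd h (≮⇒≥ n≮m , ≤-refl))

φ>1 : (0 , 1) ≻ (1 , 0)
φ>1 = ≻-by-evaluation 2 (0 , 1) (1 , 0)

φ<2 : (2 , 0) ≻ (0 , 1)
φ<2 = ≻-by-evaluation 3 (2 , 0) (0 , 1)

kφ>k : ∀ k → 1 ≤ k → (0 , k) ≻ (k , 0)
kφ>k k k≥1 = ≻-transfer (≻-scale k k≥1 φ>1) (solve (k ∷ [])) (solve (k ∷ []))

2k>kφ : ∀ k → 1 ≤ k → (k + k , 0) ≻ (0 , k)
2k>kφ k k≥1 = ≻-transfer (≻-scale k k≥1 φ<2) (solve (k ∷ [])) (solve (k ∷ []))

kφ>0 : ∀ k → 1 ≤ k → (0 , k) ≻ (0 , 0)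
kφ>0 k k≥1 = ≻-monoʳ (z≤n , z≤n) (kφ>k k k≥1)

too-large : ∀ t s → 1 ≤ s → s + s ≤ t → t * s + s * s < t * t
too-large t s s≥1 2s≤t = begin-strict
  t * s + s * s  <⟨ +-monoʳ-< (t * s) (*-monoˡ-< s {{>-nonZero s≥1}} s<t) ⟩
  t * s + t * s  ≡⟨ *-distribˡ-+ t s s ⟨
  t * (s + s)    ≤⟨ *-monoʳ-≤ t 2s≤t ⟩
  t * t          ∎
  where
  open ≤-Reasoning
  s<t : s < t
  s<t = <-≤-trans (m<m+n s s≥1) 2s≤t

descent-split : ∀ t s → 1 ≤ s → s < t → t * t ≤ t * s + s * s →
                Σ ℕ λ r → Σ ℕ λ q → t ≡ r + r + q × s ≡ r + q × 1 ≤ r × 1 ≤ q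
descent-split t s s≥1 s<t h with s ≤? t ∸ s
... | yes s≤r = ⊥-elim (<⇒≱ (too-large t s s≥1 (subst (s + s ≤_) (m+[n∸m]≡n (<⇒≤ s<t)) (+-monoʳ-≤ s s≤r))) h)
... | no s≰r = r , s ∸ r , t≡ , s≡ , m<n⇒0<n∸m s<t , m<n⇒0<n∸m r<s
  where
  r : ℕ
  r = t ∸ s
  r<s : r < s
  r<s = ≰⇒> s≰r
  s≡ : s ≡ r + (s ∸ r)
  s≡ = sym (m+[n∸m]≡n (<⇒≤ r<s))
  t≡ : t ≡ r + r + (s ∸ r)
  t≡ = trans (sym (m+[n∸m]≡n (<⇒≤ s<t)))
             (trans (+-comm s r) (trans (cong (r +_) s≡) (sym (+-assoc r r (s ∸ r)))))

-- If s ≥ 1 and t² ≤ ts + s², i.e. t/s ≤ φ (the positive root of x² = x + 1),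
-- then sφ > t; the inequality is strict because φ is irrational.  Proof by
-- descent: for s < t write (t , s) = (2r + q , r + q); then r² ≤ rq + q²,
-- q < s, and sφ > t follows from qφ > r.
φ-lower : ∀ t s → 1 ≤ s → t * t ≤ t * s + s * s → (0 , s) ≻ (t , 0)
φ-lower t s = go s (<-wellFounded s) t
  where
  go : ∀ s → Acc _<_ s → ∀ t → 1 ≤ s → t * t ≤ t * s + s * s → (0 , s) ≻ (t , 0)
  go s _ t s≥1 h with t ≤? s
  ... | yes t≤s = ≻-monoʳ (t≤s , ≤-refl) (kφ>k s s≥1)
  go s (acc rec) t s≥1 h | no t≰s with descent-split t s s≥1 (≰⇒> t≰s) h
  ... | r , q , refl , refl , r≥1 , q≥1 =
    ≻-transferφ² (go q (rec (m<n+m q r≥1)) r q≥1 invariant) (solve (r ∷ q ∷ [])) (solve (r ∷ q ∷ []))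
    where
    invariant : r * r ≤ r * q + q * q
    invariant = +-cancelʳ-≤ (3 * (r * r) + 4 * (r * q) + q * q) (r * r) (r * q + q * q) (begin
      r * r + (3 * (r * r) + 4 * (r * q) + q * q)       ≡⟨ solve (r ∷ q ∷ []) ⟩
      (r + r + q) * (r + r + q)                         ≤⟨ h ⟩
      (r + r + q) * (r + q) + (r + q) * (r + q)         ≡⟨ solve (r ∷ q ∷ []) ⟩
      r * q + q * q + (3 * (r * r) + 4 * (r * q) + q * q) ∎)
      where open ≤-Reasoning

-- If X² > Xj + j², i.e. X/j > φ, then X > jφ.  Writing X = j + s this is
-- the statement sφ > j of φ-lower.
φ-upper : ∀ X j → X * j + j * j < X * X → (X , 0) ≻ (0 , j)
φ-upper X j h with X ≤? j
... | yes X≤j = ⊥-elim (<⇒≱ h (≤-trans (*-monoʳ-≤ X X≤j) (m≤m+n (X * j) (j * j))))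
... | no X≰j = subst (λ z → (z , 0) ≻ (0 , j)) (m+[n∸m]≡n j≤X)
                 (via-φ-lower (X ∸ j) (m<n⇒0<n∸m (≰⇒> X≰j))
                   (subst (λ z → z * j + j * j < z * z) (sym (m+[n∸m]≡n j≤X)) h))
  where
  j≤X : j ≤ X
  j≤X = <⇒≤ (≰⇒> X≰j)
  via-φ-lower : ∀ s → 1 ≤ s → (j + s) * j + j * j < (j + s) * (j + s) → (j + s , 0) ≻ (0 , j)
  via-φ-lower s s≥1 h = ≻-transferφ (φ-lower j s s≥1 invariant) (solve (j ∷ s ∷ [])) (solve (j ∷ s ∷ []))
    where
    invariant : j * j ≤ j * s + s * s
    invariant = <⇒≤ (+-cancelʳ-< (j * j + j * s) (j * j) (j * s + s * s) (begin-strict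
      j * j + (j * j + j * s)       ≡⟨ solve (j ∷ s ∷ []) ⟩
      (j + s) * j + j * j           <⟨ h ⟩
      (j + s) * (j + s)             ≡⟨ solve (j ∷ s ∷ []) ⟩
      j * s + s * s + (j * j + j * s) ∎))
      where open ≤-Reasoning

-- For m ≥ 0:  2kφ = k + k√5 exceeds k + m  iff  m² < 5k²  (never equal).
√5-below : ∀ k m → 1 ≤ k → m * m ≤ 5 * (k * k) → (0 , k + k) ≻ (k + m , 0)
√5-below k m k≥1 h = φ-lower (k + m) (k + k) (≤-trans k≥1 (m≤m+n k k)) (begin
  (k + m) * (k + m)                         ≡⟨ solve (k ∷ m ∷ []) ⟩
  m * m + (k * k + 2 * (k * m))             ≤⟨ +-monoˡ-≤ (k * k + 2 * (k * m)) h ⟩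
  5 * (k * k) + (k * k + 2 * (k * m))       ≡⟨ solve (k ∷ m ∷ []) ⟩
  (k + m) * (k + k) + (k + k) * (k + k)     ∎)
  where open ≤-Reasoning

√5-above : ∀ k m → 5 * (k * k) < m * m → (k + m , 0) ≻ (0 , k + k)
√5-above k m h = φ-upper (k + m) (k + k) (begin-strict
  (k + m) * (k + k) + (k + k) * (k + k)     ≡⟨ solve (k ∷ m ∷ []) ⟩
  5 * (k * k) + (k * k + 2 * (k * m))       <⟨ +-monoˡ-< (k * k + 2 * (k * m)) h ⟩
  m * m + (k * k + 2 * (k * m))             ≡⟨ solve (k ∷ m ∷ []) ⟩
  (k + m) * (k + m)                         ∎)
  where open ≤-Reasoning

≤ᵇ-true : ∀ m n → (m ≤ᵇ n) ≡ true → m ≤ n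
≤ᵇ-true m n e = ≤ᵇ⇒≤ m n (Equivalence.from T-≡ e)

≤ᵇ-false : ∀ m n → (m ≤ᵇ n) ≡ false → n < m
≤ᵇ-false m n e = ≰⇒> λ m≤n → subst T e (≤⇒≤ᵇ m≤n)

-- The tests leφ and leφ² of Defs are instances of  √5-test c k n, which
-- asks whether 2n ≤ c + k√5:  leφ k n = √5-test k k n  and
-- leφ² k n = √5-test (3k) k n  hold definitionally.
√5-test : ℕ → ℕ → ℕ → Bool
√5-test c k n = (2 * n ≤ᵇ c) ∨ (((2 * n ∸ c) * (2 * n ∸ c)) ≤ᵇ 5 * (k * k))

√5-test-true : ∀ c k n → √5-test c k n ≡ true → (2 * n ∸ c) * (2 * n ∸ c) ≤ 5 * (k * k)
√5-test-true c k n e with 2 * n ≤ᵇ c in e₁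
... | true rewrite m≤n⇒m∸n≡0 (≤ᵇ-true (2 * n) c e₁) = z≤n
... | false = ≤ᵇ-true _ _ e

√5-test-false : ∀ c k n → √5-test c k n ≡ false →
                c + (2 * n ∸ c) ≡ n + n × 5 * (k * k) < (2 * n ∸ c) * (2 * n ∸ c)
√5-test-false c k n e with 2 * n ≤ᵇ c in e₁
... | false = trans (m+[n∸m]≡n (<⇒≤ (≤ᵇ-false (2 * n) c e₁))) (2*n≡n+n n) , ≤ᵇ-false _ _ e

2n≤c+[2n∸c] : ∀ c n → n + n ≤ c + (2 * n ∸ c)
2n≤c+[2n∸c] c n = subst (_≤ c + (2 * n ∸ c)) (2*n≡n+n n) (m≤n+m∸n (2 * n) c)

leφ-true : ∀ k n → 1 ≤ k → leφ k n ≡ true → (0 , k) ≻ (n , 0)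
leφ-true k n k≥1 e =
  ≻-halve (≻-monoʳ (2n≤c+[2n∸c] k n , z≤n) (√5-below k (2 * n ∸ k) k≥1 (√5-test-true k k n e)))

leφ-false : ∀ k n → leφ k n ≡ false → (n , 0) ≻ (0 , k)
leφ-false k n e with √5-test-false k k n e
... | sum≡ , above = ≻-halve (subst (λ z → (z , 0) ≻ (0 , k + k)) sum≡ (√5-above k (2 * n ∸ k) above))

φ-compare : ∀ k n → 1 ≤ k → (0 , k) ≻ (n , 0) ⊎ (n , 0) ≻ (0 , k)
φ-compare k n k≥1 with leφ k n in e
... | true = inj₁ (leφ-true k n k≥1 e)
... | false = inj₂ (leφ-false k n e)

-- Comparing n with kφ² = k + kφ (k ≥ 1): after adding 2k to both sides of
-- the comparisons above.
leφ²-true : ∀ k n → 1 ≤ k → leφ² k n ≡ true → (k , k) ≻ (n , 0)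
leφ²-true k n k≥1 e = ≻-halve (≻-monoʳ (2n≤c+[2n∸c] (3 * k) n , z≤n) (shift k (2 * n ∸ 3 * k)
                                 (√5-below k (2 * n ∸ 3 * k) k≥1 (√5-test-true (3 * k) k n e))))
  where
  shift : ∀ k m → (0 , k + k) ≻ (k + m , 0) → (k + k , k + k) ≻ (3 * k + m , 0)
  shift k m h = ≻-transfer h (solve (k ∷ m ∷ [])) (solve (k ∷ m ∷ []))

leφ²-false : ∀ k n → leφ² k n ≡ false → (n , 0) ≻ (k , k)
leφ²-false k n e with √5-test-false (3 * k) k n e
... | sum≡ , above = ≻-halve (subst (λ z → (z , 0) ≻ (k + k , k + k)) sum≡
                                (shift k (2 * n ∸ 3 * k) (√5-above k (2 * n ∸ 3 * k) above)))
  where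
  shift : ∀ k m → (k + m , 0) ≻ (0 , k + k) → (3 * k + m , 0) ≻ (k + k , k + k)
  shift k m h = ≻-transfer h (solve (k ∷ m ∷ [])) (solve (k ∷ m ∷ []))

-- n = ⌊x⌋ for an irrational x ∈ ℕφ:  n < x < n + 1.
_IsFloorOf_ : ℕ → ℕφ → Set
n IsFloorOf x = x ≻ (n , 0) × (1 + n , 0) ≻ x

floor-maximal : ∀ {n m x} → n IsFloorOf x → x ≻ (m , 0) → m ≤ n
floor-maximal (_ , above) x>m = ≤-pred (≻-ℕ (≻-trans above x>m))

floor-minimal : ∀ {n m x} → n IsFloorOf x → (m , 0) ≻ x → n < m
floor-minimal (below , _) m>x = ≻-ℕ (≻-trans m>x below)

floor-unique : ∀ {n m x} → n IsFloorOf x → m IsFloorOf x → n ≡ m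
floor-unique fn fm = ≤-antisym (floor-maximal fm (proj₁ fn)) (floor-maximal fn (proj₁ fm))

floor-search : ∀ x (test : ℕ → Bool) →
               (∀ n → test n ≡ true → x ≻ (n , 0)) → (∀ n → test n ≡ false → (n , 0) ≻ x) →
               x ≻ (0 , 0) → ∀ bound → (1 + bound , 0) ≻ x → findMax test bound IsFloorOf x
floor-search x test below above x>0 zero top = x>0 , top
floor-search x test below above x>0 (suc m) top with test (suc m) in e
... | true = below (suc m) e , top
... | false = floor-search x test below above x>0 m (above (suc m) e)

a-floor : ∀ k → 1 ≤ k → a k IsFloorOf (0 , k)
a-floor k k≥1 = floor-search (0 , k) (leφ k) (λ n → leφ-true k n k≥1) (leφ-false k)
  (kφ>0 k k≥1) (3 * k) (≻-monoˡ (2k≤3k+1 , z≤n) (2k>kφ k k≥1))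
  where 2k≤3k+1 : k + k ≤ 1 + 3 * k
        2k≤3k+1 = ≤-trans (+-monoʳ-≤ k (m≤m+n k (k + 0))) (n≤1+n _)

b-floor : ∀ k → 1 ≤ k → b k IsFloorOf (k , k)
b-floor k k≥1 = floor-search (k , k) (leφ² k) (λ n → leφ²-true k n k≥1) (leφ²-false k)
  (≻-monoˡ (z≤n , ≤-refl) (kφ>0 k k≥1)) (3 * k) (≻-monoˡ (n≤1+n _ , ≤-refl) 3k>kφ²)
  where
  3k>kφ² : (3 * k , 0) ≻ (k , k)
  3k>kφ² = ≻-transfer (≻-scale k k≥1 (≻-by-evaluation 3 (3 , 0) (1 , 1))) (solve (k ∷ [])) (solve (k ∷ []))

a-unique : ∀ j {n} → 1 ≤ j → n IsFloorOf (0 , j) → a j ≡ n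
a-unique j j≥1 = floor-unique (a-floor j j≥1)

b-unique : ∀ j {n} → 1 ≤ j → n IsFloorOf (j , j) → b j ≡ n
b-unique j j≥1 = floor-unique (b-floor j j≥1)

a-lower : ∀ k → 1 ≤ k → k ≤ a k
a-lower k k≥1 = floor-maximal (a-floor k k≥1) (kφ>k k k≥1)

a-upper : ∀ k → 1 ≤ k → a k < k + k
a-upper k k≥1 = floor-minimal (a-floor k k≥1) (2k>kφ k k≥1)

b-lower : ∀ k → 1 ≤ k → k ≤ b k
b-lower k k≥1 = floor-maximal (b-floor k k≥1) (≻-transfer (kφ>0 k k≥1) (solve (k ∷ [])) (solve (k ∷ [])))

-- a is strictly increasing:  (k + 1)φ = kφ + φ > a(k) + 1.
a-increasing : ∀ k → 1 ≤ k → a k < a (suc k)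
a-increasing k k≥1 = floor-maximal (a-floor (suc k) (s≤s z≤n)) (step (proj₁ (a-floor k k≥1)))
  where
  step : ∀ {k n} → (0 , k) ≻ (n , 0) → (0 , 1 + k) ≻ (1 + n , 0)
  step {k} {n} h = ≻-transfer (≻-+ h φ>1) (solve (k ∷ n ∷ [])) (solve (k ∷ n ∷ []))

-- Since k ≤ a(k) < 2k, every k ≥ 1 can be written k = 1 + t + v with
-- a(k) = 1 + 2t + v; most floor computations below are made in these
-- coordinates, where all quantities are polynomials in t and v.
record Window (k : ℕ) : Set where
  field
    t v : ℕ
    k≡ : k ≡ 1 + t + v
    a≡ : a k ≡ 1 + 2 * t + v
    floor : (1 + 2 * t + v) IsFloorOf (0 , 1 + t + v)

window : ∀ k → 1 ≤ k → Window k
window k k≥1 = record { t = t ; v = k ∸ suc t ; k≡ = k≡ ; a≡ = a≡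
                      ; floor = subst₂ (λ K A → A IsFloorOf (0 , K)) k≡ a≡ (a-floor k k≥1) }
  where
  t : ℕ
  t = a k ∸ k
  a≡k+t : a k ≡ k + t
  a≡k+t = sym (m+[n∸m]≡n (a-lower k k≥1))
  t<k : t < k
  t<k = +-cancelˡ-< k t k (subst (_< k + k) a≡k+t (a-upper k k≥1))
  k≡ : k ≡ 1 + t + (k ∸ suc t)
  k≡ = sym (m+[n∸m]≡n t<k)
  a≡ : a k ≡ 1 + 2 * t + (k ∸ suc t)
  a≡ = trans a≡k+t (trans (cong (_+ t) k≡) (rearrange t (k ∸ suc t)))
    where rearrange : ∀ t v → 1 + t + v + t ≡ 1 + 2 * t + v
          rearrange t v = solve (t ∷ v ∷ [])

existsPos-intro : ∀ n p j → 1 ≤ j → j ≤ n → p j ≡ true → existsPos n p ≡ true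
existsPos-intro zero p j j≥1 j≤0 pj = ⊥-elim (<⇒≱ j≥1 j≤0)
existsPos-intro (suc n) p j j≥1 j≤n pj with m≤n⇒m<n∨m≡n j≤n
... | inj₂ refl = cong (_∨ existsPos n p) pj
... | inj₁ j<n = trans (cong (p (suc n) ∨_) (existsPos-intro n p j j≥1 (≤-pred j<n) pj)) (∨-zeroʳ (p (suc n)))

existsPos-elim : ∀ n p → existsPos n p ≡ true → Σ ℕ λ j → 1 ≤ j × p j ≡ true
existsPos-elim (suc n) p h with p (suc n) in e
... | true = suc n , s≤s z≤n , e
... | false = existsPos-elim n p h

≡ᵇ-refl : ∀ n → (n ≡ᵇ n) ≡ true
≡ᵇ-refl n = Equivalence.to T-≡ (≡⇒≡ᵇ n n refl)

≡ᵇ-sound : ∀ {m n} → (m ≡ᵇ n) ≡ true → m ≡ n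
≡ᵇ-sound {m} {n} e = ≡ᵇ⇒≡ m n (Equivalence.from T-≡ e)

-- The values a(j), b(j) (j ≥ 1) belong to A, B; the witness j is found by
-- the bounded search of Defs because j ≤ a(j), b(j).
a∈A : ∀ j {n} → 1 ≤ j → a j ≡ n → InA n
a∈A j j≥1 refl = existsPos-intro (a j) (λ k → a k ≡ᵇ a j) j j≥1 (a-lower j j≥1) (≡ᵇ-refl (a j))

b∈B : ∀ j {n} → 1 ≤ j → b j ≡ n → InB n
b∈B j j≥1 refl = existsPos-intro (b j) (λ k → b k ≡ᵇ b j) j j≥1 (b-lower j j≥1) (≡ᵇ-refl (b j))

-- Beatty's theorem, with the extra information used for C: every n ≥ 1 is
-- a value of a, or else a value of b and one more than a value of a.
data BeattyCase (n : ℕ) : Set where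
  value-of-a : ∀ j → 1 ≤ j → a j ≡ n → BeattyCase n
  value-of-b : ∀ j → 1 ≤ j → b j ≡ n → ∀ i → 1 ≤ i → 1 + a i ≡ n → BeattyCase n

-- φ < 2, so (1 + t)φ > 2 + t + v forces t ≥ 1.
large⇒t≥1 : ∀ t v → (0 , 1 + t) ≻ (2 + t + v , 0) → 1 ≤ t
large⇒t≥1 zero v large = ⊥-elim (≻-asym (≻-monoʳ (s≤s (s≤s z≤n) , z≤n) large) φ<2)
large⇒t≥1 (suc t) v _ = s≤s z≤n

-- With n = 1 + t + v in window coordinates, n = a(1 + t) when (1 + t)φ < 2 + t + v,
-- and otherwise n = b(1 + v) = 1 + a(t).
beatty-case : ∀ n → 1 ≤ n → BeattyCase n
beatty-case n n≥1 with window n n≥1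
... | record { t = t ; v = v ; k≡ = refl ; floor = lower , upper }
    with φ-compare (1 + t) (2 + t + v) (s≤s z≤n)
...   | inj₂ small = value-of-a (1 + t) (s≤s z≤n) (a-unique (1 + t) (s≤s z≤n)
          (≻-transfer (≻-φ· upper) (solve (t ∷ v ∷ [])) (solve (t ∷ v ∷ [])) , small))
...   | inj₁ large = value-of-b (1 + v) (s≤s z≤n) (b-unique (1 + v) (s≤s z≤n)
          (≻-transfer (≻-+ lower (≻-φ· lower)) (solve (t ∷ v ∷ [])) (solve (t ∷ v ∷ [])) ,
           ≻-transfer (≻-φ· large) (solve (t ∷ v ∷ [])) (solve (t ∷ v ∷ []))))
          t t≥1 (cong suc (a-unique t t≥1
          (≻-transfer (≻-+ large φ<2) (solve (t ∷ v ∷ [])) (solve (t ∷ v ∷ [])) ,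
           ≻-transfer (≻-φ· lower) (solve (t ∷ v ∷ [])) (solve (t ∷ v ∷ [])))))
  where t≥1 : 1 ≤ t
        t≥1 = large⇒t≥1 t v large

beatty : ∀ n → 1 ≤ n → InA n ⊎ InB n
beatty n n≥1 with beatty-case n n≥1
... | value-of-a j j≥1 e = inj₁ (a∈A j j≥1 e)
... | value-of-b j j≥1 e _ _ _ = inj₂ (b∈B j j≥1 e)

-- a(a(j)) = a(j) + j − 1  and  a(a(j) + 1) = a(j) + j + 1, in window coordinates.
a∘a : ∀ t v → (1 + 2 * t + v) IsFloorOf (0 , 1 + t + v) → a (1 + 2 * t + v) ≡ 1 + 3 * t + 2 * v
a∘a t v (lower , upper) = a-unique (1 + 2 * t + v) (s≤s z≤n)
  (≻-transferφ (≻-+ upper φ>1) (solve (t ∷ v ∷ [])) (solve (t ∷ v ∷ [])) ,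
   ≻-transferφ lower (solve (t ∷ v ∷ [])) (solve (t ∷ v ∷ [])))

a∘suc∘a : ∀ t v → (1 + 2 * t + v) IsFloorOf (0 , 1 + t + v) → a (2 + 2 * t + v) ≡ 3 + 3 * t + 2 * v
a∘suc∘a t v (lower , upper) = a-unique (2 + 2 * t + v) (s≤s z≤n)
  (≻-transferφ upper (solve (t ∷ v ∷ [])) (solve (t ∷ v ∷ [])) ,
   ≻-transferφ (≻-+ lower φ>1) (solve (t ∷ v ∷ [])) (solve (t ∷ v ∷ [])))

record Enumerates (X : ℕ → Bool) (e : ℕ → ℕ) : Set where
  field
    positive : 1 ≤ e 1
    increasing : ∀ i → 1 ≤ i → e i < e (suc i)
    member : ∀ i → 1 ≤ i → X (e i) ≡ true
    complete : ∀ n → X n ≡ true → Σ ℕ λ i → 1 ≤ i × e i ≡ n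

count-suc : ∀ X m → 1 ≤ m → countBelow X (suc m) ≡ countBelow X m + (if X m then 1 else 0)
count-suc X (suc m) _ = refl

count-flat : ∀ X p q → 1 ≤ p → p ≤ q → (∀ n → p ≤ n → n < q → X n ≡ false) →
             countBelow X q ≡ countBelow X p
count-flat X p zero p≥1 p≤0 _ = ⊥-elim (<⇒≱ p≥1 p≤0)
count-flat X p (suc q) p≥1 p≤q free with m≤n⇒m<n∨m≡n p≤q
... | inj₂ refl = refl
... | inj₁ p<q = begin
  countBelow X (suc q)                            ≡⟨ count-suc X q (≤-trans p≥1 p≤q') ⟩
  countBelow X q + (if X q then 1 else 0)         ≡⟨ cong (λ x → countBelow X q + (if x then 1 else 0)) (free q p≤q' ≤-refl) ⟩
  countBelow X q + 0                              ≡⟨ +-identityʳ _ ⟩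
  countBelow X q                                  ≡⟨ count-flat X p q p≥1 p≤q' (λ n p≤n n<q → free n p≤n (m≤n⇒m≤1+n n<q)) ⟩
  countBelow X p                                  ∎
  where
  open ≡-Reasoning
  p≤q' : p ≤ q
  p≤q' = ≤-pred p<q

module Enumeration {X : ℕ → Bool} {e : ℕ → ℕ} (E : Enumerates X e) where
  open Enumerates E

  monotone : ∀ {i j} → 1 ≤ i → i ≤ j → e i ≤ e j
  monotone {i} {zero} i≥1 i≤j = ⊥-elim (<⇒≱ i≥1 i≤j)
  monotone {i} {suc j} i≥1 i≤j with m≤n⇒m<n∨m≡n i≤j
  ... | inj₂ refl = ≤-refl
  ... | inj₁ i<j = ≤-trans (monotone i≥1 (≤-pred i<j)) (<⇒≤ (increasing j (≤-trans i≥1 (≤-pred i<j))))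

  below-first : ∀ n → n < e 1 → X n ≡ false
  below-first n n<e₁ with X n in Xn
  ... | false = refl
  ... | true with complete n Xn
  ...   | j , j≥1 , refl = ⊥-elim (<⇒≱ n<e₁ (monotone (s≤s z≤n) j≥1))

  between : ∀ i n → 1 ≤ i → e i < n → n < e (suc i) → X n ≡ false
  between i n i≥1 lo hi with X n in Xn
  ... | false = refl
  ... | true with complete n Xn
  ...   | j , j≥1 , refl with j ≤? i
  ...     | yes j≤i = ⊥-elim (<⇒≱ lo (monotone j≥1 j≤i))
  ...     | no j≰i = ⊥-elim (<⇒≱ hi (monotone (s≤s z≤n) (≰⇒> j≰i)))

  count : ∀ k → 1 ≤ k → suc (countBelow X (e k)) ≡ k
  count (suc zero) _ = cong suc (count-flat X 1 (e 1) (s≤s z≤n) positive (λ n _ → below-first n))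
  count (suc (suc k)) _ = begin
    suc (countBelow X (e (2 + k)))                        ≡⟨ cong suc (count-flat X (suc (e (1 + k))) (e (2 + k)) (s≤s z≤n) (increasing (1 + k) (s≤s z≤n))
                                                                     (λ n → between (1 + k) n (s≤s z≤n))) ⟩
    suc (countBelow X (suc (e (1 + k))))                  ≡⟨ cong suc (count-suc X (e (1 + k)) (≤-trans positive (monotone (s≤s z≤n) (s≤s z≤n)))) ⟩
    suc (countBelow X (e (1 + k)) + (if X (e (1 + k)) then 1 else 0)) ≡⟨ cong (λ x → suc (countBelow X (e (1 + k)) + (if x then 1 else 0))) (member (1 + k) (s≤s z≤n)) ⟩
    suc (countBelow X (e (1 + k)) + 1)                    ≡⟨ cong suc (+-comm _ 1) ⟩
    suc (suc (countBelow X (e (1 + k))))                  ≡⟨ cong suc (count (suc k) (s≤s z≤n)) ⟩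
    suc (suc k)                                           ∎
    where open ≡-Reasoning

  positive-at : ∀ i → 1 ≤ i → 1 ≤ e i
  positive-at i i≥1 = ≤-trans positive (monotone (s≤s z≤n) i≥1)

  kth : ∀ k → 1 ≤ k → KthSmallest X k (e k)
  kth k k≥1 = positive-at k k≥1 , member k k≥1 , count k k≥1

pm-cases : ∀ X r n → pm X r n ≡ true → X (n + r) ≡ true ⊎ (r ≤ n × X (n ∸ r) ≡ true)
pm-cases X r n h with X (n + r) in X[n+r]
... | true = inj₁ refl
... | false with r ≤ᵇ n in r≤n
...   | true = inj₂ (≤ᵇ-true r n r≤n , h)

pm-plus : ∀ X r n → X (n + r) ≡ true → pm X r n ≡ true
pm-plus X r n h = cong (_∨ ((r ≤ᵇ n) ∧ X (n ∸ r))) h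

pm-minus : ∀ X r m → X m ≡ true → pm X r (m + r) ≡ true
pm-minus X r m h = trans (cong (X (m + r + r) ∨_) (cong₂ _∧_ r≤m+r (trans (cong X (m+n∸n≡m m r)) h)))
                         (∨-zeroʳ _)
  where r≤m+r : (r ≤ᵇ m + r) ≡ true
        r≤m+r = Equivalence.to T-≡ (≤⇒≤ᵇ (m≤n+m r m))

-- twice i = 2i, by recursion so that twice (1 + i) = 2 + twice i.
twice : ℕ → ℕ
twice zero = zero
twice (suc i) = suc (suc (twice i))

-- e(1) − 1, e(1) + 1, e(2) − 1, e(2) + 1, …
interleave : (ℕ → ℕ) → ℕ → ℕ
interleave e zero = zero
interleave e (suc zero) = e 1 ∸ 1
interleave e (suc (suc zero)) = e 1 + 1
interleave e (suc (suc (suc k))) = interleave (λ i → e (suc i)) (suc k)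

interleave-odd : ∀ e i → interleave e (suc (twice i)) ≡ e (suc i) ∸ 1
interleave-odd e zero = refl
interleave-odd e (suc i) = interleave-odd (λ j → e (suc j)) i

interleave-even : ∀ e i → interleave e (suc (suc (twice i))) ≡ e (suc i) + 1
interleave-even e zero = refl
interleave-even e (suc i) = interleave-even (λ j → e (suc j)) i

interleave-increasing : ∀ e → (∀ i → 1 ≤ i → e i + 3 ≤ e (suc i)) →
                        ∀ k → 1 ≤ k → interleave e k < interleave e (suc k)
interleave-increasing e gap (suc zero) _ = ≤-<-trans (m∸n≤m (e 1) 1) (m<m+n (e 1) (s≤s z≤n))
interleave-increasing e gap (suc (suc zero)) _ =
  subst (_≤ e 2 ∸ 1) (x+3∸1 (e 1)) (∸-monoˡ-≤ 1 (gap 1 (s≤s z≤n)))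
  where x+3∸1 : ∀ x → x + 3 ∸ 1 ≡ suc (x + 1)
        x+3∸1 x = trans (cong (_∸ 1) (+-suc x 2)) (+-suc x 1)
interleave-increasing e gap (suc (suc (suc k))) _ =
  interleave-increasing (λ i → e (suc i)) (λ i _ → gap (suc i) (s≤s z≤n)) (suc k) (s≤s z≤n)

interleave-member : ∀ X e → (∀ i → 1 ≤ i → X (e i) ≡ true) → (∀ i → 1 ≤ i → 1 ≤ e i) →
                    ∀ k → 1 ≤ k → pm X 1 (interleave e k) ≡ true
interleave-member X e mem pos (suc zero) _ =
  pm-plus X 1 (e 1 ∸ 1) (subst (λ z → X z ≡ true) (sym (m∸n+n≡m (pos 1 (s≤s z≤n)))) (mem 1 (s≤s z≤n)))
interleave-member X e mem pos (suc (suc zero)) _ = pm-minus X 1 (e 1) (mem 1 (s≤s z≤n))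
interleave-member X e mem pos (suc (suc (suc k))) _ =
  interleave-member X (λ i → e (suc i)) (λ i _ → mem (suc i) (s≤s z≤n)) (λ i _ → pos (suc i) (s≤s z≤n))
                    (suc k) (s≤s z≤n)

interleave-enumerates : ∀ {X e} → Enumerates X e → (∀ i → 1 ≤ i → e i + 3 ≤ e (suc i)) → 2 ≤ e 1 →
                        Enumerates (pm X 1) (interleave e)
interleave-enumerates {X} {e} E gap e₁≥2 = record
  { positive = ∸-monoˡ-≤ 1 e₁≥2
  ; increasing = interleave-increasing e gap
  ; member = interleave-member X e member positive-at
  ; complete = complete′
  }
  where
  open Enumerates E
  open Enumeration E using (positive-at)
  complete′ : ∀ n → pm X 1 n ≡ true → Σ ℕ λ k → 1 ≤ k × interleave e k ≡ n
  complete′ n h with pm-cases X 1 n h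
  ... | inj₁ X[n+1] with complete (n + 1) X[n+1]
  ...   | suc i , _ , e≡ = suc (twice i) , s≤s z≤n ,
            trans (interleave-odd e i) (trans (cong (_∸ 1) e≡) (m+n∸n≡m n 1))
  complete′ n h | inj₂ (1≤n , X[n∸1]) with complete (n ∸ 1) X[n∸1]
  ...   | suc i , _ , e≡ = suc (suc (twice i)) , s≤s z≤n ,
            trans (interleave-even e i) (trans (cong (_+ 1) e≡) (m∸n+n≡m 1≤n))

d : ℕ → ℕ
d k = 3 * a k + k

d-enumerates : Enumerates inD d
d-enumerates = record
  { positive = m≤n+m 1 (3 * a 1)
  ; increasing = λ i i≥1 → +-mono-≤-< (*-monoʳ-≤ 3 (<⇒≤ (a-increasing i i≥1))) (n<1+n i)
  ; member = λ i i≥1 → existsPos-intro (d i) (λ k → 3 * a k + k ≡ᵇ d i) i i≥1 (m≤n+m i _) (≡ᵇ-refl (d i))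
  ; complete = λ n h → let j , j≥1 , e = existsPos-elim n _ h in j , j≥1 , ≡ᵇ-sound e
  }

-- c(i) = a(i) + 2i − 1 enumerates C = D ± 2.  By Beatty, i = a(j) or
-- i = a(j) + 1, and then c(i) = d(j) − 2, resp. d(j) + 2.
c : ℕ → ℕ
c i = a i + i + (i ∸ 1)

c∘a : ∀ j → 1 ≤ j → c (a j) + 2 ≡ d j
c∘a j j≥1 with window j j≥1
... | record { t = t ; v = v ; k≡ = refl ; a≡ = a≡ ; floor = floor } = begin
  c (a (1 + t + v)) + 2                                  ≡⟨ cong (λ α → c α + 2) a≡ ⟩
  a (1 + 2 * t + v) + (1 + 2 * t + v) + (2 * t + v) + 2  ≡⟨ cong (λ α → α + (1 + 2 * t + v) + (2 * t + v) + 2) (a∘a t v floor) ⟩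
  1 + 3 * t + 2 * v + (1 + 2 * t + v) + (2 * t + v) + 2  ≡⟨ solve (t ∷ v ∷ []) ⟩
  3 * (1 + 2 * t + v) + (1 + t + v)                      ≡⟨ cong (λ α → 3 * α + (1 + t + v)) a≡ ⟨
  d (1 + t + v)                                          ∎
  where open ≡-Reasoning

c∘suc∘a : ∀ j → 1 ≤ j → c (1 + a j) ≡ d j + 2
c∘suc∘a j j≥1 with window j j≥1
... | record { t = t ; v = v ; k≡ = refl ; a≡ = a≡ ; floor = floor } = begin
  c (1 + a (1 + t + v))                                  ≡⟨ cong (λ α → c (1 + α)) a≡ ⟩
  a (2 + 2 * t + v) + (2 + 2 * t + v) + (1 + 2 * t + v)  ≡⟨ cong (λ α → α + (2 + 2 * t + v) + (1 + 2 * t + v)) (a∘suc∘a t v floor) ⟩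
  3 + 3 * t + 2 * v + (2 + 2 * t + v) + (1 + 2 * t + v)  ≡⟨ solve (t ∷ v ∷ []) ⟩
  3 * (1 + 2 * t + v) + (1 + t + v) + 2                  ≡⟨ cong (λ α → 3 * α + (1 + t + v) + 2) a≡ ⟨
  d (1 + t + v) + 2                                      ∎
  where open ≡-Reasoning

c-gap : ∀ i → 1 ≤ i → c i + 3 ≤ c (suc i)
c-gap (suc i) _ = begin
  a (suc i) + suc i + i + 3               ≡⟨ rearrange (a (suc i)) i ⟩
  suc (a (suc i)) + suc (suc i) + suc i   ≤⟨ +-monoˡ-≤ (suc i) (+-monoˡ-≤ (suc (suc i)) (a-increasing (suc i) (s≤s z≤n))) ⟩
  a (suc (suc i)) + suc (suc i) + suc i   ∎
  where
  open ≤-Reasoning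
  rearrange : ∀ α i → α + suc i + i + 3 ≡ suc α + suc (suc i) + suc i
  rearrange α i = solve (α ∷ i ∷ [])

c-enumerates : Enumerates inC c
c-enumerates = record
  { positive = ≤-trans (m≤n+m 1 (a 1)) (m≤m+n _ 0)
  ; increasing = λ i i≥1 → <-≤-trans (m<m+n (c i) (s≤s z≤n)) (c-gap i i≥1)
  ; member = member
  ; complete = complete
  }
  where
  open Enumerates d-enumerates using () renaming (member to d-member; complete to d-complete)
  member : ∀ i → 1 ≤ i → inC (c i) ≡ true
  member i i≥1 with beatty-case i i≥1
  ... | value-of-a j j≥1 refl = pm-plus inD 2 (c (a j)) (subst (λ n → inD n ≡ true) (sym (c∘a j j≥1)) (d-member j j≥1))
  ... | value-of-b _ _ _ j j≥1 refl = subst (λ n → inC n ≡ true) (sym (c∘suc∘a j j≥1)) (pm-minus inD 2 (d j) (d-member j j≥1))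
  complete : ∀ n → inC n ≡ true → Σ ℕ λ i → 1 ≤ i × c i ≡ n
  complete n h with pm-cases inD 2 n h
  ... | inj₁ D[n+2] with d-complete (n + 2) D[n+2]
  ...   | j , j≥1 , d≡ = a j , ≤-trans j≥1 (a-lower j j≥1) , +-cancelʳ-≡ 2 (c (a j)) n (trans (c∘a j j≥1) d≡)
  complete n h | inj₂ (2≤n , D[n∸2]) with d-complete (n ∸ 2) D[n∸2]
  ...   | j , j≥1 , d≡ = 1 + a j , s≤s z≤n , trans (c∘suc∘a j j≥1) (trans (cong (_+ 2) d≡) (m∸n+n≡m 2≤n))

s : ℕ → ℕ
s = interleave c

s-enumerates : Enumerates inS s
s-enumerates = interleave-enumerates c-enumerates c-gap c₁≥2
  where c₁≥2 : 2 ≤ c 1   -- c(1) = a(1) + 1 = 2, by evaluation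
        c₁≥2 = ≤-refl

d-value-of-a : ∀ t v → (0 , 1 + t + v) ≻ (1 + 2 * t + v , 0) →
               (5 + 7 * t + 4 * v , 0) ≻ (0 , 3 + 4 * t + 3 * v) → a (3 + 4 * t + 3 * v) ≡ 4 + 7 * t + 4 * v
d-value-of-a t v lower φ<d+1 = a-unique (3 + 4 * t + 3 * v) (s≤s z≤n)
  (≻-transferφ² (≻-+ (≻-+ lower lower) (≻-φ· lower)) (solve (t ∷ v ∷ [])) (solve (t ∷ v ∷ [])) , φ<d+1)

CDPattern : ℕ → ℕ → Set
CDPattern c d = (InA c × InA d) ⊎ (InB c × InA d) ⊎ (InA c × InB d)

-- Which
-- pattern occurs depends on the position of (3 + 4t + 3v)φ relative to
-- d(k) + 1 and of (2 + 4t + 3v)φ relative to d(k) − 1; each case exhibits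
-- c(k) and d(k) as explicit values of a and b, the floor bounds being
-- combinations of the window bounds and of the case hypotheses.
cd-pattern-window : ∀ t v → (1 + 2 * t + v) IsFloorOf (0 , 1 + t + v) →
                    CDPattern (2 + 4 * t + 3 * v) (4 + 7 * t + 4 * v)
cd-pattern-window t v (lower , upper) with φ-compare (3 + 4 * t + 3 * v) (5 + 7 * t + 4 * v) (s≤s z≤n)
-- Case (3 + 4t + 3v)φ > d(k) + 1:  c(k) = a(2 + 3t + v),  d(k) = b(2 + 3t + v).
... | inj₁ d+1<φ = inj₂ (inj₂ (a∈A (2 + 3 * t + v) (s≤s z≤n) c≡ , b∈B (2 + 3 * t + v) (s≤s z≤n) d≡))
  where
  c≡ : a (2 + 3 * t + v) ≡ 2 + 4 * t + 3 * v
  c≡ = a-unique (2 + 3 * t + v) (s≤s z≤n)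
         (≻-transfer (≻-+ (≻-+ (≻-+ upper upper) (≻-φ· upper)) d+1<φ) (solve (t ∷ v ∷ [])) (solve (t ∷ v ∷ [])) ,
          ≻-transfer (≻-φ· d+1<φ) (solve (t ∷ v ∷ [])) (solve (t ∷ v ∷ [])))
  d≡ : b (2 + 3 * t + v) ≡ 4 + 7 * t + 4 * v
  d≡ = b-unique (2 + 3 * t + v) (s≤s z≤n)
         (≻-transfer (≻-+ (≻-+ (≻-+ upper upper) (≻-φ· upper)) d+1<φ) (solve (t ∷ v ∷ [])) (solve (t ∷ v ∷ [])) ,
          ≻-transfer (≻-φ· d+1<φ) (solve (t ∷ v ∷ [])) (solve (t ∷ v ∷ [])))
... | inj₂ φ<d+1 with φ-compare (2 + 4 * t + 3 * v) (3 + 7 * t + 4 * v) (s≤s z≤n)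
-- Case (2 + 4t + 3v)φ > d(k) − 1 (and the first case fails):  c(k) = b(1 + t + 2v).
...   | inj₁ d-1<φ = inj₂ (inj₁ (b∈B (1 + t + 2 * v) (s≤s z≤n) c≡ , a∈A (3 + 4 * t + 3 * v) (s≤s z≤n) (d-value-of-a t v lower φ<d+1)))
  where
  c≡ : b (1 + t + 2 * v) ≡ 2 + 4 * t + 3 * v
  c≡ = b-unique (1 + t + 2 * v) (s≤s z≤n)
         (≻-transfer (≻-+ d-1<φ (≻-φ· d-1<φ)) (solve (t ∷ v ∷ [])) (solve (t ∷ v ∷ [])) ,
          ≻-transfer (≻-+ φ<d+1 (≻-φ· φ<d+1)) (solve (t ∷ v ∷ [])) (solve (t ∷ v ∷ [])))
-- Case (2 + 4t + 3v)φ < d(k) − 1:  c(k) = a(1 + 3t + v).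
...   | inj₂ φ<d-1 = inj₁ (a∈A (1 + 3 * t + v) (s≤s z≤n) c≡ , a∈A (3 + 4 * t + 3 * v) (s≤s z≤n) (d-value-of-a t v lower φ<d+1))
  where
  c≡ : a (1 + 3 * t + v) ≡ 2 + 4 * t + 3 * v
  c≡ = a-unique (1 + 3 * t + v) (s≤s z≤n)
         (≻-transfer (≻-φ· φ<d-1) (solve (t ∷ v ∷ [])) (solve (t ∷ v ∷ [])) ,
          ≻-transferφ (≻-+ (≻-+ lower lower) (≻-φ· lower)) (solve (t ∷ v ∷ [])) (solve (t ∷ v ∷ [])))

cd-pattern : ∀ k → 1 ≤ k → CDPattern (c k) (d k)
cd-pattern k k≥1 with window k k≥1
... | record { t = t ; v = v ; k≡ = refl ; a≡ = a≡ ; floor = floor } =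
  subst₂ CDPattern (sym c≡) (sym d≡) (cd-pattern-window t v floor)
  where
  c≡ : c (1 + t + v) ≡ 2 + 4 * t + 3 * v
  c≡ = trans (cong (λ α → α + (1 + t + v) + (t + v)) a≡) (solve (t ∷ v ∷ []))
  d≡ : d (1 + t + v) ≡ 4 + 7 * t + 4 * v
  d≡ = trans (cong (λ α → 3 * α + (1 + t + v)) a≡) (solve (t ∷ v ∷ []))

Pattern : ℕ → ℕ → ℕ → Set
Pattern s c d = (InA s × InA c × InA d) ⊎ (InA s × InA c × InB d) ⊎ (InA s × InB c × InA d) ⊎
                (InB s × InA c × InA d) ⊎ (InB s × InB c × InA d) ⊎ (InB s × InA c × InB d)

combine : ∀ s c d → InA s ⊎ InB s → CDPattern c d → Pattern s c d
combine _ _ _ (inj₁ sA) (inj₁ (cA , dA)) = inj₁ (sA , cA , dA)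
combine _ _ _ (inj₁ sA) (inj₂ (inj₁ (cB , dA))) = inj₂ (inj₂ (inj₁ (sA , cB , dA)))
combine _ _ _ (inj₁ sA) (inj₂ (inj₂ (cA , dB))) = inj₂ (inj₁ (sA , cA , dB))
combine _ _ _ (inj₂ sB) (inj₁ (cA , dA)) = inj₂ (inj₂ (inj₂ (inj₁ (sB , cA , dA))))
combine _ _ _ (inj₂ sB) (inj₂ (inj₁ (cB , dA))) = inj₂ (inj₂ (inj₂ (inj₂ (inj₁ (sB , cB , dA)))))
combine _ _ _ (inj₂ sB) (inj₂ (inj₂ (cA , dB))) = inj₂ (inj₂ (inj₂ (inj₂ (inj₂ (sB , cA , dB)))))

theorem4p8 : (k : ℕ) → 1 ≤ k →
    Σ ℕ λ s → Σ ℕ λ c → Σ ℕ λ d →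
      KthSmallest inS k s × KthSmallest inC k c × KthSmallest inD k d ×
      ((InA s × InA c × InA d) ⊎ (InA s × InA c × InB d) ⊎ (InA s × InB c × InA d) ⊎
       (InB s × InA c × InA d) ⊎ (InB s × InB c × InA d) ⊎ (InB s × InA c × InB d))
theorem4p8 k k≥1 =
  s k , c k , d k , s-kth , Enumeration.kth c-enumerates k k≥1 , Enumeration.kth d-enumerates k k≥1 ,
  combine (s k) (c k) (d k) (beatty (s k) (proj₁ s-kth)) (cd-pattern k k≥1)
  where
  s-kth : KthSmallest inS k (s k)
  s-kth = Enumeration.kth s-enumerates k k≥1
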